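{- Let $A=\{a,b,c\}$ with $P_a=\{p_a\}$, $P_b=\{p_b\}$, $P_c=\{p_c\}$. Let $\mathcal C=(C,\chi,\ell)$ be the simplicial model with vertices $u,v,w,x$ where $\chi(u)=a,\ \ell(u)=\{p_a\}$; $\chi(v)=b,\ \ell(v)=\varnothing$; $\chi(w)=b,\ \ell(w)=\varnothing$; $\chi(x)=c,\ \ell(x)=\{p_c\}$, and whose facets are $X=\{v,u\}$ and $Y=\{u,w,x\}$ (so $C$ consists of all nonempty subsets of $X$ or of $Y$). Let $\mathcal C'=(C',\chi',\ell')$ be the simplicial model with vertices $u',w',x'$ where $\chi'(u')=a,\ \ell'(u')=\{p_a\}$; $\chi'(w')=b,\ \ell'(w')=\varnothing$; $\chi'(x')=c,\ \ell'(x')=\{p_c\}$, with the single facet $Y'=\{u',w',x'\}$. Then $(\mathcal C,Y)\equiv_{\mathcal L^- }(\mathcal C',Y')$.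
   Context: The language $\mathcal L^-$ (over agents $A$ and local atoms $P_a$, $a\in A$) is given by $\varphi::=p_a\mid\neg\varphi\mid(\varphi\wedge\varphi)\mid\widehat K_a\varphi$ with $a\in A$, $p_a\in P_a$; $K_a\varphi:=\neg\widehat K_a\neg\varphi$. A simplicial model $\mathcal C=(C,\chi,\ell)$ consists of a nonempty set $C$ of nonempty finite subsets (simplexes) of a vertex set $\mathcal V$, closed under taking nonempty subsets and containing all singletons; a map $\chi:\mathcal V\to A$ injective on every simplex; a map $\ell$ assigning to each vertex $v$ a subset of $P_{\chi(v)}$. $\chi(X)=\{\chi(v)\mid v\in X\}$, $\ell(X)=\bigcup_{v\in X}\ell(v)$; facets are maximal simplexes, $\mathcal F(C)$ the set of facets. Definability/satisfaction at a facet $X$: $\mathcal C,X\bowtie p_a$ iff $a\in\chi(X)$; $\bowtie$ of $\neg\varphi$ equals that of $\varphi$; $\varphi\wedge\psi$ is defined iff both are; $\mathcal C,X\bowtie\widehat K_a\varphi$ iff $\mathcal C,Z\bowtie\varphi$ for some facet $Z$ with $a\in\chi(X\cap Z)$. $\mathcal C,X\vDash p_a$ iff $p_a\in\ell(X)$; $\mathcal C,X\vDash\neg\varphi$ iff $\mathcal C,X\bowtie\varphi$ and $\mathcal C,X\nvDash\varphi$; $\vDash$ of a conjunction iff both conjuncts hold; $\mathcal C,X\vDash\widehat K_a\varphi$ iff $\mathcal C,Z\vDash\varphi$ for some facet $Z$ with $a\in\chi(X\cap Z)$. $(\mathcal C,Y)\equiv_{\mathcal L^- }(\mathcal C',Y')$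 means that for every $\varphi\in\mathcal L^-$: $\mathcal C,Y\bowtie\varphi\iff\mathcal C',Y'\bowtie\varphi$; $\mathcal C,Y\vDash\varphi\iff\mathcal C',Y'\vDash\varphi$; $\mathcal C,Y\vDash\neg\varphi\iff\mathcal C',Y'\vDash\neg\varphi$. -}

module Defs where

open import Level using (0ℓ)
open import Data.Unit using (⊤; tt)
open import Data.Empty using (⊥)
open import Data.Product using (Σ; ∃; _×_; _,_)
open import Data.Sum using (_⊎_)
open import Data.List using (List; []; _∷_)
open import Data.List.Membership.Propositional using (_∈_)
open import Data.List.Relation.Unary.All using (All)
open import Data.List.Relation.Binary.Subset.Propositional using (_⊆_)
open import Relation.Binary.PropositionalEquality using (_≡_)
open import Relation.Nullary using (¬_)
open import Function.Bundles using (_⇔_)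

data Form (A : Set) (P : A → Set) : Set where
  atom : (a : A) → P a → Form A P
  ¬'_  : Form A P → Form A P
  _∧'_ : Form A P → Form A P → Form A P
  K̂    : A → Form A P → Form A P

K : {A : Set} {P : A → Set} → A → Form A P → Form A P
K a φ = ¬' (K̂ a (¬' φ))

-- Simplicial models. Simplexes (finite nonempty sets of vertices) are
-- represented as lists of vertices, read as the set of their elements.

record SimplicialModel (A : Set) (P : A → Set) : Set₁ where
  field
    V : Set
    C : List V → Set
    χ : V → A
    ℓ : (v : V) → P (χ v) → Set

module _ {A : Set} {P : A → Set} (M : SimplicialModel A P) where
  open SimplicialModel M

  Facet : List V → Set
  Facet X = C X × (∀ Z → C Z → X ⊆ Z → Z ⊆ X)

  _∈χ_ : A → List V → Set
  a ∈χ X = ∃ λ v → v ∈ X × χ v ≡ a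

  InterCol : A → List V → List V → Set
  InterCol a X Z = ∃ λ v → v ∈ X × v ∈ Z × χ v ≡ a

  InLab : (a : A) → P a → List V → Set
  InLab a p X = ∃ λ v → v ∈ X × Σ (χ v ≡ a) λ e → ℓ v (subst′ e p)
    where
      subst′ : ∀ {x y} → x ≡ y → P y → P x
      subst′ Relation.Binary.PropositionalEquality.refl q = q

  Def : List V → Form A P → Set
  Def X (atom a p) = a ∈χ X
  Def X (¬' φ)     = Def X φ
  Def X (φ ∧' ψ)   = Def X φ × Def X ψ
  Def X (K̂ a φ)    = ∃ λ Z → Facet Z × InterCol a X Z × Def Z φ

  Sat : List V → Form A P → Set
  Sat X (atom a p) = InLab a p X
  Sat X (¬' φ)     = Def X φ × ¬ Sat X φ
  Sat X (φ ∧' ψ)   = Sat X φ × Sat X ψ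
  Sat X (K̂ a φ)    = ∃ λ Z → Facet Z × InterCol a X Z × Sat Z φ

_,_≡L⁻_,_ : {A : Set} {P : A → Set} →
            (M : SimplicialModel A P) → List (SimplicialModel.V M) →
            (M' : SimplicialModel A P) → List (SimplicialModel.V M') → Set
M , Y ≡L⁻ M' , Y' = ∀ φ →
    (Def M Y φ ⇔ Def M' Y' φ)
  × (Sat M Y φ ⇔ Sat M' Y' φ)
  × (Sat M Y (¬' φ) ⇔ Sat M' Y' (¬' φ))

data Ag : Set where
  a b c : Ag

Pat : Ag → Set
Pat _ = ⊤

data V₁ : Set where
  u v w x : V₁

χ₁ : V₁ → Ag
χ₁ u = a
χ₁ v = b
χ₁ w = b
χ₁ x = c

ℓ₁ : (z : V₁) → Pat (χ₁ z) → Set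
ℓ₁ u _ = ⊤
ℓ₁ v _ = ⊥
ℓ₁ w _ = ⊥
ℓ₁ x _ = ⊤

X₁ Y₁ : List V₁
X₁ = v ∷ u ∷ []
Y₁ = u ∷ w ∷ x ∷ []

NonEmpty : {T : Set} → List T → Set
NonEmpty [] = ⊥
NonEmpty (_ ∷ _) = ⊤

C₁ : List V₁ → Set
C₁ L = NonEmpty L × (All (_∈ X₁) L ⊎ All (_∈ Y₁) L)

𝒞 : SimplicialModel Ag Pat
𝒞 = record { V = V₁ ; C = C₁ ; χ = χ₁ ; ℓ = ℓ₁ }

data V₂ : Set where
  u' w' x' : V₂

χ₂ : V₂ → Ag
χ₂ u' = a
χ₂ w' = b
χ₂ x' = c

ℓ₂ : (z : V₂) → Pat (χ₂ z) → Set
ℓ₂ u' _ = ⊤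
ℓ₂ w' _ = ⊥
ℓ₂ x' _ = ⊤

Y₂ : List V₂
Y₂ = u' ∷ w' ∷ x' ∷ []

C₂ : List V₂ → Set
C₂ L = NonEmpty L × All (_∈ Y₂) L

𝒞' : SimplicialModel Ag Pat
𝒞' = record { V = V₂ ; C = C₂ ; χ = χ₂ ; ℓ = ℓ₂ }

{-# OPTIONS --safe #-}
module Submission where

open import Defs
open import Data.Unit using (⊤; tt)
open import Data.Empty using (⊥; ⊥-elim)
open import Data.Product using (∃; _×_; _,_; proj₁)
open import Data.Product.Function.NonDependent.Propositional using (_×-⇔_)
open import Data.Sum using (inj₁; inj₂)
open import Data.List using (List)
open import Data.List.Relation.Unary.Any using (here; there)
open import Data.List.Membership.Propositional using (_∈_)
open import Data.List.Relation.Unary.All using (lookup; tabulate)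
open import Data.List.Relation.Binary.Subset.Propositional using (_⊆_)
open import Data.List.Relation.Binary.Subset.Propositional.Properties using (⊆-refl)
open import Relation.Binary.PropositionalEquality using (refl)
open import Function using (_∘_; id)
open import Function.Bundles using (_⇔_; mk⇔; Equivalence)

-- In both models a vertex carries its atom exactly when its colour is a or c,
-- so an atom is true at a simplex iff it is defined there and its colour is a
-- or c.  The only facet Y' of C' contains every colour; hence every simplex Z
-- of C is simulated by every facet of C': what is definable at Z is definable
-- there, with the same truth value.  For K̂ₐψ read from right to left, the
-- facet witnessing K̂ₐψ on the left is the one given by the definability of
-- K̂ₐψ at Z, which works because every simplex of C is related to every facet
-- of C'.  Since Y also contains every colour, definability at Y' transfers
-- back to Y.

module _ {A : Set} {P : A → Set} where

  ∈χ-mono : ∀ (M : SimplicialModel A P) {ag X Z} → X ⊆ Z → _∈χ_ M ag X → _∈χ_ M ag Z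
  ∈χ-mono _ X⊆Z (z , z∈X , χz≡ag) = z , X⊆Z z∈X , χz≡ag

  InterCol-⊆ : ∀ (M : SimplicialModel A P) {ag X Z} → X ⊆ Z → _∈χ_ M ag X → InterCol M ag Z X
  InterCol-⊆ _ X⊆Z (z , z∈X , χz≡ag) = z , X⊆Z z∈X , z∈X , χz≡ag

  sat⇒def : ∀ {M : SimplicialModel A P} {X} φ → Sat M X φ → Def M X φ
  sat⇒def (atom _ _) (z , z∈X , χz≡ag , _) = z , z∈X , χz≡ag
  sat⇒def (¬' φ)     (d , _)              = d
  sat⇒def (φ ∧' ψ)   (sφ , sψ)            = sat⇒def φ sφ , sat⇒def ψ sψ
  sat⇒def (K̂ _ φ)    (Z , fZ , i , s)     = Z , fZ , i , sat⇒def φ s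

  LabelledBy : SimplicialModel A P → ((ag : A) → P ag → Set) → Set
  LabelledBy M L = ∀ {ag p X} → InLab M ag p X ⇔ (L ag p × _∈χ_ M ag X)

  module _ (M M' : SimplicialModel A P) where
    private
      module M  = SimplicialModel M
      module M' = SimplicialModel M'

    record DefSimulation : Set₁ where
      field
        _∼_     : List M.V → List M'.V → Set
        colours : ∀ {ag Z Z'} → Z ∼ Z' → _∈χ_ M ag Z → _∈χ_ M' ag Z'
        forth   : ∀ {ag Z Z' W} → Z ∼ Z' → Facet M W → InterCol M ag Z W →
                  ∃ λ W' → Facet M' W' × InterCol M' ag Z' W' × W ∼ W'

      def-transfer : ∀ {Z Z'} φ → Z ∼ Z' → Def M Z φ → Def M' Z' φ
      def-transfer (atom _ _) r d         = colours r d
      def-transfer (¬' φ)     r d         = def-transfer φ r d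
      def-transfer (φ ∧' ψ)   r (dφ , dψ) = def-transfer φ r dφ , def-transfer ψ r dψ
      def-transfer (K̂ _ φ)    r (W , fW , i , d) with forth r fW i
      ... | W' , fW' , i' , r' = W' , fW' , i' , def-transfer φ r' d

    record SatSimulation : Set₁ where
      field
        simulation : DefSimulation
      open DefSimulation simulation public
      field
        labels : ∀ {ag p Z Z'} → Z ∼ Z' → _∈χ_ M ag Z → InLab M ag p Z ⇔ InLab M' ag p Z'
        back   : ∀ {ag Z Z' W W'} → Z ∼ Z' → Facet M W → Facet M' W' →
                 InterCol M ag Z W → InterCol M' ag Z' W' → W ∼ W'

      sat-transfer : ∀ {Z Z'} φ → Z ∼ Z' → Def M Z φ → Sat M Z φ ⇔ Sat M' Z' φ
      sat-transfer (atom _ _) r d = labels r d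
      sat-transfer (¬' φ) r d =
        mk⇔ (λ (_ , ¬s) → def-transfer φ r d , ¬s ∘ Equivalence.from ih)
            (λ (_ , ¬s') → d , ¬s' ∘ Equivalence.to ih)
        where ih = sat-transfer φ r d
      sat-transfer (φ ∧' ψ) r (dφ , dψ) = sat-transfer φ r dφ ×-⇔ sat-transfer ψ r dψ
      sat-transfer {Z} {Z'} (K̂ ag φ) r (W₀ , fW₀ , i₀ , d₀) = mk⇔ to from
        where
        to : Sat M Z (K̂ ag φ) → Sat M' Z' (K̂ ag φ)
        to (W , fW , i , s) with forth r fW i
        ... | W' , fW' , i' , r' =
          W' , fW' , i' , Equivalence.to (sat-transfer φ r' (sat⇒def φ s)) s
        from : Sat M' Z' (K̂ ag φ) → Sat M Z (K̂ ag φ)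
        from (W' , fW' , i' , s') =
          W₀ , fW₀ , i₀ , Equivalence.from (sat-transfer φ (back r fW₀ fW' i₀ i') d₀) s'

  labels-agree : ∀ (M M' : SimplicialModel A P) {L ag p Z Z'} →
                 LabelledBy M L → LabelledBy M' L →
                 (_∈χ_ M ag Z → _∈χ_ M' ag Z') → _∈χ_ M ag Z → InLab M ag p Z ⇔ InLab M' ag p Z'
  labels-agree _ _ byL byL' colours ag∈Z =
    mk⇔ (λ i → Equivalence.from byL' (proj₁ (Equivalence.to byL i) , colours ag∈Z))
        (λ i' → Equivalence.from byL (proj₁ (Equivalence.to byL' i') , ag∈Z))

Labelled : (ag : Ag) → Pat ag → Set
Labelled a _ = ⊤
Labelled b _ = ⊥
Labelled c _ = ⊤

𝒞-labelled : LabelledBy 𝒞 Labelled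
𝒞-labelled = mk⇔ to from
  where
  to : ∀ {ag p Z} → InLab 𝒞 ag p Z → Labelled ag p × _∈χ_ 𝒞 ag Z
  to (u , m , refl , _) = tt , u , m , refl
  to (x , m , refl , _) = tt , x , m , refl
  from : ∀ {ag p Z} → Labelled ag p × _∈χ_ 𝒞 ag Z → InLab 𝒞 ag p Z
  from (_ , u , m , refl) = u , m , refl , tt
  from (_ , x , m , refl) = x , m , refl , tt

𝒞'-labelled : LabelledBy 𝒞' Labelled
𝒞'-labelled = mk⇔ to from
  where
  to : ∀ {ag p Z} → InLab 𝒞' ag p Z → Labelled ag p × _∈χ_ 𝒞' ag Z
  to (u' , m , refl , _) = tt , u' , m , refl
  to (x' , m , refl , _) = tt , x' , m , refl
  from : ∀ {ag p Z} → Labelled ag p × _∈χ_ 𝒞' ag Z → InLab 𝒞' ag p Z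
  from (_ , u' , m , refl) = u' , m , refl , tt
  from (_ , x' , m , refl) = x' , m , refl , tt

Y₁-colourful : ∀ ag → _∈χ_ 𝒞 ag Y₁
Y₁-colourful a = u , here refl , refl
Y₁-colourful b = w , there (here refl) , refl
Y₁-colourful c = x , there (there (here refl)) , refl

Y₂-colourful : ∀ ag → _∈χ_ 𝒞' ag Y₂
Y₂-colourful a = u' , here refl , refl
Y₂-colourful b = w' , there (here refl) , refl
Y₂-colourful c = x' , there (there (here refl)) , refl

w∉X₁ : w ∈ X₁ → ⊥
w∉X₁ (there (here ()))
w∉X₁ (there (there ()))

Y₁-facet : Facet 𝒞 Y₁
Y₁-facet = (tt , inj₂ (tabulate id)) , maximal
  where
  maximal : ∀ Z → C₁ Z → Y₁ ⊆ Z → Z ⊆ Y₁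
  maximal Z (_ , inj₁ Z⊆X₁) Y₁⊆Z = ⊥-elim (w∉X₁ (lookup Z⊆X₁ (Y₁⊆Z (there (here refl)))))
  maximal Z (_ , inj₂ Z⊆Y₁) _    = lookup Z⊆Y₁

Y₂-facet : Facet 𝒞' Y₂
Y₂-facet = (tt , tabulate id) , λ { Z (_ , Z⊆Y₂) _ → lookup Z⊆Y₂ }

Y₂⊆facet : ∀ {Z} → Facet 𝒞' Z → Y₂ ⊆ Z
Y₂⊆facet ((_ , Z⊆Y₂) , maximal) = maximal Y₂ (tt , tabulate id) (lookup Z⊆Y₂)

𝒞⇒𝒞' : SatSimulation 𝒞 𝒞'
𝒞⇒𝒞' = record
  { simulation = record
    { _∼_     = λ _ Z' → Y₂ ⊆ Z'
    ; colours = λ {ag} Y₂⊆Z' _ → ∈χ-mono 𝒞' Y₂⊆Z' (Y₂-colourful ag)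
    ; forth   = λ {ag} Y₂⊆Z' _ _ → Y₂ , Y₂-facet , InterCol-⊆ 𝒞' Y₂⊆Z' (Y₂-colourful ag) , ⊆-refl
    }
  ; labels = λ {ag} Y₂⊆Z' → labels-agree 𝒞 𝒞' 𝒞-labelled 𝒞'-labelled
                              (λ _ → ∈χ-mono 𝒞' Y₂⊆Z' (Y₂-colourful ag))
  ; back   = λ _ _ fW' _ _ → Y₂⊆facet fW'
  }

𝒞'⇒𝒞 : DefSimulation 𝒞' 𝒞
𝒞'⇒𝒞 = record
  { _∼_     = λ _ Z → Y₁ ⊆ Z
  ; colours = λ {ag} Y₁⊆Z _ → ∈χ-mono 𝒞 Y₁⊆Z (Y₁-colourful ag)
  ; forth   = λ {ag} Y₁⊆Z _ _ → Y₁ , Y₁-facet , InterCol-⊆ 𝒞 Y₁⊆Z (Y₁-colourful ag) , ⊆-refl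
  }

proposition3p3 : 𝒞 , Y₁ ≡L⁻ 𝒞' , Y₂
proposition3p3 φ = def⇔ φ , sat⇔ φ , sat⇔ (¬' φ)
  where
  open SatSimulation 𝒞⇒𝒞' using (def-transfer; sat-transfer)
  def⇔ : ∀ φ → Def 𝒞 Y₁ φ ⇔ Def 𝒞' Y₂ φ
  def⇔ φ = mk⇔ (def-transfer φ ⊆-refl) (DefSimulation.def-transfer 𝒞'⇒𝒞 φ ⊆-refl)
  sat⇔ : ∀ φ → Sat 𝒞 Y₁ φ ⇔ Sat 𝒞' Y₂ φ
  sat⇔ φ = mk⇔ (λ s → Equivalence.to (sat-transfer φ ⊆-refl (sat⇒def φ s)) s)
               (λ s' → Equivalence.from (sat-transfer φ ⊆-refl (def-back (sat⇒def φ s'))) s')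
    where def-back = Equivalence.from (def⇔ φ)
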